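{- Let $k\ge2$, $\ell\in\mathbb{N}_0$, and let $a\colon\mathbb{N}_0\to\{+1,-1\}$ be a pattern counting sequence of length $\le\ell$. Then there exist admissible sets $B,C\subset\Sigma_k^*$ such that no word in $B$ begins with $\mathtt 0$, every word in $C$ has length exactly $\ell$, and $a=a_B=a_C$. Moreover, $B$ and $C$ are uniquely determined by $a$.
   Context: $\Sigma_k=\{\mathtt 0,\dots,k-1\}$, $\Sigma_k^*$ the set of finite words over $\Sigma_k$; $(n)_k$ is the base-$k$ expansion of $n$ without leading zeros. For a word $v$ not of the form $\mathtt 0^j$ ($j\ge0$) and $n\in\mathbb{N}_0$, $\#(v,n)$ is the number of pairs of words $(x,y)$ with $\mathtt 0^{|v|-1}(n)_k=xvy$. A set $A\subset\Sigma_k^*$ is admissible if it is finite and contains no word of the form $\mathtt 0^j$ ($j\ge0$); then $a_A(n)=(-1)^{\sum_{v\in A}\#(v,n)}$. A pattern counting sequence of length $\le\ell$ is a sequence $a_A$ with $A$ admissible and all words of $A$ of length $\le\ell$. -}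

module Defs where

open import Data.Nat using (ℕ; zero; suc; _+_; _∸_; _≤_; _<_; z≤n; s≤s; NonZero; >-nonZero; _/_)
open import Data.Nat.Properties using (≤-trans)
open import Data.Nat.DivMod using (_mod_)
open import Data.Fin using (Fin; toℕ; fromℕ<)
open import Data.Fin.Properties using () renaming (_≟_ to _≟ᶠ_)
open import Data.Integer using (ℤ; -_; 1ℤ)
open import Data.List using (List; []; _∷_; _++_; length; replicate; reverse; map)
open import Data.Nat.ListAction using (sum)
open import Data.List.Relation.Unary.All using (All)
open import Data.List.Relation.Unary.Unique.Propositional using (Unique)
open import Data.List.Membership.Propositional using (_∈_)
open import Data.Product using (_×_; Σ; ∃; _,_)
open import Data.Bool using (Bool; true; false; _∧_)
open import Relation.Nullary using (¬_; does)
open import Relation.Binary.PropositionalEquality using (_≡_)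

Word : ℕ → Set
Word k = List (Fin k)

zeroDigit : {k : ℕ} → 2 ≤ k → Fin k
zeroDigit h = fromℕ< (≤-trans (s≤s z≤n) h)

-- A word is of the form 0^j (j ≥ 0), i.e. all its letters are 0 (includes the empty word).
IsZeroPower : {k : ℕ} → Word k → Set
IsZeroPower w = All (λ d → toℕ d ≡ 0) w

-- Reversed base-k digits of n (least significant first), computed with fuel;
-- fuel n suffices since n / k < n for n > 0.
digitsRev : (k : ℕ) → 2 ≤ k → (fuel n : ℕ) → Word k
digitsRev k h zero n = []
digitsRev k h (suc fuel) zero = []
digitsRev k h (suc fuel) (suc m) =
  let instance nz : NonZero k
               nz = >-nonZero (≤-trans (s≤s z≤n) h)
  in (suc m mod k) ∷ digitsRev k h fuel (suc m / k)

-- (n)_k : base-k expansion of n without leading zeros, most significant digit first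
-- ((0)_k is the empty word).
expansion : (k : ℕ) → 2 ≤ k → ℕ → Word k
expansion k h n = reverse (digitsRev k h n n)

isPrefix : {k : ℕ} → Word k → Word k → Bool
isPrefix [] w = true
isPrefix (a ∷ v) [] = false
isPrefix (a ∷ v) (b ∷ w) = does (a ≟ᶠ b) ∧ isPrefix v w

-- Number of pairs (x , y) with w = x v y  (= number of occurrences of v as a factor of w).
occ : {k : ℕ} → Word k → Word k → ℕ
occ v [] with isPrefix v []
... | true = 1
... | false = 0
occ v (c ∷ w) with isPrefix v (c ∷ w)
... | true = suc (occ v w)
... | false = occ v w

count : (k : ℕ) → (h : 2 ≤ k) → Word k → ℕ → ℕ
count k h v n = occ v (replicate (length v ∸ 1) (zeroDigit h) ++ expansion k h n)

-- Finite sets of words are represented by duplicate-free lists.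
-- A is admissible: finite (a duplicate-free list) and containing no word 0^j.
Admissible : {k : ℕ} → List (Word k) → Set
Admissible A = Unique A × All (λ v → ¬ IsZeroPower v) A

negOnePow : ℕ → ℤ
negOnePow zero = 1ℤ
negOnePow (suc s) = - negOnePow s

patSeq : (k : ℕ) → (h : 2 ≤ k) → List (Word k) → ℕ → ℤ
patSeq k h A n = negOnePow (sum (map (λ v → count k h v n) A))

IsPatternCountingSeq : (k : ℕ) → 2 ≤ k → ℕ → (ℕ → ℤ) → Set
IsPatternCountingSeq k h ℓ a =
  Σ (List (Word k)) λ A → Admissible A × All (λ v → length v ≤ ℓ) A × (∀ n → a n ≡ patSeq k h A n)

SameSet : {k : ℕ} → List (Word k) → List (Word k) → Set
SameSet A B = ∀ w → (w ∈ A → w ∈ B) × (w ∈ B → w ∈ A)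

NoLeadingZero : {k : ℕ} → List (Word k) → Set
NoLeadingZero B = All (λ v → ∀ d u → v ≡ d ∷ u → ¬ toℕ d ≡ 0) B

AllLength : {k : ℕ} → ℕ → List (Word k) → Set
AllLength ℓ C = All (λ v → length v ≡ ℓ) C

module Submission where

-- Write N_A(n) = Σ_{v ∈ A} #(v, n), so that a_A(n) = (-1)^{N_A(n)}.  Only the
-- parities of the N_A(n) matter.  The key identity is that for a nonempty word v
-- Σ_{c ∈ Σ_k} #(c v, n) = #(v, n): the padding 0^{|v|} in front of (n)_k supplies
-- the letter preceding every occurrence of v.  Hence, modulo 2,
--   * v may be replaced by its k^{ℓ-|v|} left extensions of length ℓ, and
--   * a leading zero 0 u may be replaced by u together with the words c u, c ≠ 0;
-- after cancelling equal words in pairs, this gives the sets C and B.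
-- Uniqueness: for w ≠ 0^j take n with (n)_k = strip w (w without leading zeros).
-- Then #(w, n) = 1, and every v ≠ 0^j with #(v, n) > 0 has |strip v| ≤ |strip w|,
-- with equality only if strip v = strip w.  In both classes of words a word is
-- determined by its stripped form, so an induction on |strip w| shows that two
-- duplicate-free lists in the class with the same sequence have the same members.

open import Defs
open import Data.Nat using (ℕ; zero; suc; _+_; _*_; _∸_; _≤_; _<_; z≤n; s≤s; _/_; _%_)
  renaming (_≟_ to _≟ℕ_)
open import Data.Nat.Properties
open import Data.Nat.DivMod using (_mod_; [m+kn]%n≡m%n; m<n⇒m%n≡m; +-distrib-/-∣ʳ; m<n⇒m/n≡0; m*n/n≡m)
open import Data.Nat.Divisibility using (n∣m*n)
open import Data.Nat.ListAction using (sum)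
open import Data.Nat.ListAction.Properties using (sum-++)
open import Data.Integer using (ℤ; -_)
open import Data.Integer.Properties using (neg-involutive; neg-injective)
open import Data.Bool using (Bool; true; false; _∧_)
open import Data.Fin using (Fin; zero; suc; toℕ)
open import Data.Fin.Properties using (toℕ-fromℕ<; toℕ<n; toℕ-injective) renaming (_≟_ to _≟ᶠ_)
open import Data.List using (List; []; _∷_; _++_; length; replicate; reverse; map; concatMap; allFin; tabulate)
open import Data.List.Properties
  using (≡-dec; map-++; map-∘; map-tabulate; length-++; length-replicate; reverse-involutive; unfold-reverse)
open import Data.List.Relation.Unary.All as All using (All; []; _∷_)
open import Data.List.Relation.Unary.All.Properties using (─⁺; ++⁺; concat⁺; map⁺)
open import Data.List.Relation.Unary.Any using (here; there; _─_)
open import Data.List.Relation.Unary.AllPairs using ([]; _∷_)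
open import Data.List.Relation.Unary.Unique.Propositional using (Unique)
open import Data.List.Relation.Unary.Unique.Propositional.Properties using (Unique[x∷xs]⇒x∉xs)
open import Data.List.Membership.Propositional using (_∈_; _∉_)
open import Data.Product using (Σ; ∃-syntax; _×_; _,_; proj₁; proj₂; swap)
open import Data.Sum using (inj₁; inj₂)
open import Data.Empty using (⊥-elim)
open import Data.Unit using (⊤; tt)
open import Function using (id; _∘_; case_of_)
open import Relation.Nullary using (¬_; yes; no; does)
open import Relation.Nullary.Decidable using (decidable-stable; dec-true)
open import Relation.Binary.Definitions using (DecidableEquality)
open import Relation.Binary.PropositionalEquality
open import Algebra.Properties.CommutativeMonoid.Sum +-0-commutativeMonoid
  using (sum-syntax; ∑-distrib-+; sum-cong-≗; sum-replicate-zero) renaming (sum to ∑)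
open import Algebra.Properties.CommutativeSemigroup +-commutativeSemigroup using (x∙yz≈y∙xz)
open ≡-Reasoning

-- m ≈₂ n : m and n have the same parity, in the form (-1)^m = (-1)^n in which
-- parities enter the sequences a_A.
infix 4 _≈₂_
_≈₂_ : ℕ → ℕ → Set
m ≈₂ n = negOnePow m ≡ negOnePow n

≈₂-+ˡ : ∀ c {a b} → a ≈₂ b → c + a ≈₂ c + b
≈₂-+ˡ zero    a≈b = a≈b
≈₂-+ˡ (suc c) a≈b = cong -_ (≈₂-+ˡ c a≈b)

≈₂-+ : ∀ {a a′ b b′} → a ≈₂ a′ → b ≈₂ b′ → a + b ≈₂ a′ + b′
≈₂-+ {a} {a′} {b} {b′} a≈a′ b≈b′ = begin
  negOnePow (a + b)   ≡⟨ ≈₂-+ˡ a b≈b′ ⟩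
  negOnePow (a + b′)  ≡⟨ cong negOnePow (+-comm a b′) ⟩
  negOnePow (b′ + a)  ≡⟨ ≈₂-+ˡ b′ a≈a′ ⟩
  negOnePow (b′ + a′) ≡⟨ cong negOnePow (+-comm b′ a′) ⟩
  negOnePow (a′ + b′) ∎

double-≈₂ : ∀ c s → c + (c + s) ≈₂ s
double-≈₂ zero    s = refl
double-≈₂ (suc c) s = begin
  - negOnePow (c + suc (c + s)) ≡⟨ cong (λ t → - negOnePow t) (+-suc c (c + s)) ⟩
  - - negOnePow (c + (c + s))   ≡⟨ neg-involutive _ ⟩
  negOnePow (c + (c + s))       ≡⟨ double-≈₂ c s ⟩
  negOnePow s                   ∎

suc-≉₂ : ∀ s → ¬ (suc s ≈₂ s)
suc-≉₂ zero    ()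
suc-≉₂ (suc s) e = suc-≉₂ s (neg-injective e)

infix 4 _≐_
_≐_ : {A : Set} → List A → List A → Set
X ≐ Y = ∀ v → (v ∈ X → v ∈ Y) × (v ∈ Y → v ∈ X)

total : {A : Set} → (A → ℕ) → List A → ℕ
total f L = sum (map f L)

module _ {A : Set} (f : A → ℕ) where

  total-++ : ∀ L M → total f (L ++ M) ≡ total f L + total f M
  total-++ L M = trans (cong sum (map-++ f L M)) (sum-++ (map f L) (map f M))

  total-concatMap : {B : Set} (g : B → List A) (L : List B) →
    total f (concatMap g L) ≡ total (total f ∘ g) L
  total-concatMap g []      = refl
  total-concatMap g (x ∷ L) =
    trans (total-++ (g x) (concatMap g L)) (cong (total f (g x) +_) (total-concatMap g L))

  total-zero : ∀ L → (∀ {x} → x ∈ L → f x ≡ 0) → total f L ≡ 0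
  total-zero []      _   = refl
  total-zero (x ∷ L) f≡0 = cong₂ _+_ (f≡0 (here refl)) (total-zero L (f≡0 ∘ there))

  total-map : {B : Set} (g : B → A) (L : List B) → total f (map g L) ≡ total (f ∘ g) L
  total-map g L = cong sum (sym (map-∘ L))

  total-─ : ∀ {w} L (w∈L : w ∈ L) → total f L ≡ f w + total f (L ─ w∈L)
  total-─ (x ∷ L) (here refl) = refl
  total-─ {w} (x ∷ L) (there w∈L) = begin
    f x + total f L                   ≡⟨ cong (f x +_) (total-─ L w∈L) ⟩
    f x + (f w + total f (L ─ w∈L))   ≡⟨ x∙yz≈y∙xz (f x) (f w) _ ⟩
    f w + (f x + total f (L ─ w∈L))   ∎

total-cong : {A : Set} {f g : A → ℕ} (L : List A) → (∀ {x} → x ∈ L → f x ≡ g x) → total f L ≡ total g L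
total-cong []      f≡g = refl
total-cong (x ∷ L) f≡g = cong₂ _+_ (f≡g (here refl)) (total-cong L (f≡g ∘ there))

total-≈₂ : {A : Set} {f g : A → ℕ} (L : List A) → (∀ {x} → x ∈ L → f x ≈₂ g x) → total f L ≈₂ total g L
total-≈₂ []      f≈g = refl
total-≈₂ {f = f} {g} (x ∷ L) f≈g = ≈₂-+ {f x} {g x} {total f L} {total g L} (f≈g (here refl)) (total-≈₂ L (f≈g ∘ there))

module _ {A : Set} where

  ∈-─⁻ : ∀ {v w : A} L (w∈L : w ∈ L) → v ∈ (L ─ w∈L) → v ∈ L
  ∈-─⁻ (x ∷ L) (here refl) v∈     = there v∈
  ∈-─⁻ (x ∷ L) (there w∈L) (here v≡x) = here v≡x
  ∈-─⁻ (x ∷ L) (there w∈L) (there v∈) = there (∈-─⁻ L w∈L v∈)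

  ∈-─⁺ : ∀ {v w : A} L (w∈L : w ∈ L) → v ∈ L → v ≢ w → v ∈ (L ─ w∈L)
  ∈-─⁺ (x ∷ L) (here refl) (here refl) v≢w = ⊥-elim (v≢w refl)
  ∈-─⁺ (x ∷ L) (here refl) (there v∈L) v≢w = v∈L
  ∈-─⁺ (x ∷ L) (there w∈L) (here v≡x)  v≢w = here v≡x
  ∈-─⁺ (x ∷ L) (there w∈L) (there v∈L) v≢w = there (∈-─⁺ L w∈L v∈L v≢w)

  unique-─ : ∀ {w : A} L (w∈L : w ∈ L) → Unique L → Unique (L ─ w∈L)
  unique-─ (x ∷ L) (here refl) (_ ∷ uL)     = uL
  unique-─ (x ∷ L) (there w∈L) (x∉L ∷ uL) = ─⁺ w∈L x∉L ∷ unique-─ L w∈L uL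

  ∉-─ : ∀ {w : A} L (w∈L : w ∈ L) → Unique L → w ∉ (L ─ w∈L)
  ∉-─ (x ∷ L) (here refl) uxL = Unique[x∷xs]⇒x∉xs uxL
  ∉-─ (x ∷ L) (there w∈L) (x∉L ∷ uL) (here refl) = All.lookup x∉L w∈L refl
  ∉-─ (x ∷ L) (there w∈L) (x∉L ∷ uL) (there w∈) = ∉-─ L w∈L uL w∈

-- Normalisation: cancelling equal elements in pairs turns a list into a
-- duplicate-free one without changing the parity of any total.
module Normalisation {A : Set} (_≟_ : DecidableEquality A) where

  open import Data.List.Membership.DecPropositional _≟_ using (_∈?_)

  toggle : A → List A → List A
  toggle w M with w ∈? M
  ... | yes w∈M = M ─ w∈M
  ... | no  _   = w ∷ M

  normalise : List A → List A
  normalise []      = []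
  normalise (w ∷ L) = toggle w (normalise L)

  toggle-unique : ∀ w M → Unique M → Unique (toggle w M)
  toggle-unique w M uM with w ∈? M
  ... | yes w∈M = unique-─ M w∈M uM
  ... | no  w∉M = All.tabulate (λ { v∈M refl → w∉M v∈M }) ∷ uM

  toggle-⊆ : ∀ {v} w M → v ∈ toggle w M → v ∈ w ∷ M
  toggle-⊆ w M v∈ with w ∈? M
  ... | yes w∈M = there (∈-─⁻ M w∈M v∈)
  ... | no  _   = v∈

  toggle-≈₂ : (f : A → ℕ) → ∀ w M → total f (toggle w M) ≈₂ f w + total f M
  toggle-≈₂ f w M with w ∈? M
  ... | yes w∈M = sym (trans (cong (λ t → negOnePow (f w + t)) (total-─ f M w∈M))
                             (double-≈₂ (f w) (total f (M ─ w∈M))))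
  ... | no  _   = refl

  normalise-unique : ∀ L → Unique (normalise L)
  normalise-unique []      = []
  normalise-unique (w ∷ L) = toggle-unique w (normalise L) (normalise-unique L)

  normalise-⊆ : ∀ {v} L → v ∈ normalise L → v ∈ L
  normalise-⊆ (w ∷ L) v∈ with toggle-⊆ w (normalise L) v∈
  ... | here v≡w = here v≡w
  ... | there v∈′ = there (normalise-⊆ L v∈′)

  normalise-≈₂ : (f : A → ℕ) → ∀ L → total f (normalise L) ≈₂ total f L
  normalise-≈₂ f []      = refl
  normalise-≈₂ f (w ∷ L) = trans (toggle-≈₂ f w (normalise L))
    (≈₂-+ {f w} {f w} {total f (normalise L)} {total f L} refl (normalise-≈₂ f L))

total-support : {A : Set} (g : A → ℕ) → ∀ X Y → Unique X → Unique Y →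
  (∀ v → g v ≢ 0 → (v ∈ X → v ∈ Y) × (v ∈ Y → v ∈ X)) → total g X ≡ total g Y
total-support g [] Y _ _ agree = sym (total-zero g Y vanishes)
  where
    vanishes : ∀ {v} → v ∈ Y → g v ≡ 0
    vanishes {v} v∈Y = decidable-stable (g v ≟ℕ 0) (λ g≢0 → case proj₂ (agree v g≢0) v∈Y of λ ())
total-support g (x ∷ X) Y (x∉X ∷ uX) uY agree with g x ≟ℕ 0
... | yes gx≡0 = cong₂ _+_ gx≡0 (total-support g X Y uX uY agree′)
  where
    agree′ : ∀ v → g v ≢ 0 → (v ∈ X → v ∈ Y) × (v ∈ Y → v ∈ X)
    agree′ v gv≢0 = proj₁ (agree v gv≢0) ∘ there , λ v∈Y → case proj₂ (agree v gv≢0) v∈Y of λ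
      { (here refl) → ⊥-elim (gv≢0 gx≡0) ; (there v∈X) → v∈X }
... | no gx≢0 = begin
    g x + total g X            ≡⟨ cong (g x +_) (total-support g X (Y ─ x∈Y) uX (unique-─ Y x∈Y uY) agree′) ⟩
    g x + total g (Y ─ x∈Y)    ≡⟨ sym (total-─ g Y x∈Y) ⟩
    total g Y                  ∎
  where
    x∈Y : x ∈ Y
    x∈Y = proj₁ (agree x gx≢0) (here refl)
    agree′ : ∀ v → g v ≢ 0 → (v ∈ X → v ∈ (Y ─ x∈Y)) × (v ∈ (Y ─ x∈Y) → v ∈ X)
    agree′ v gv≢0 =
      (λ v∈X → ∈-─⁺ Y x∈Y (proj₁ (agree v gv≢0) (there v∈X)) λ { refl → All.lookup x∉X v∈X refl }) ,
      (λ v∈ → case proj₂ (agree v gv≢0) (∈-─⁻ Y x∈Y v∈) of λ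
         { (here refl) → ⊥-elim (∉-─ Y x∈Y uY v∈) ; (there v∈X) → v∈X })

-- Duplicate-free lists are determined by the parities of their totals under a
-- family f of counting functions that separates the elements triangularly.
module Determination {A : Set} (_≟_ : DecidableEquality A)
                     (P : A → Set) (rank : A → ℕ) (f : A → ℕ → ℕ) where

  open import Data.List.Membership.DecPropositional _≟_ using (_∈?_)

  Separating : Set
  Separating = ∀ w → P w →
    ∃[ n ] f w n ≡ 1 × (∀ v → P v → f v n ≢ 0 → v ≢ w → rank v < rank w)

  SameParities : List A → List A → Set
  SameParities X Y = ∀ n → total (λ v → f v n) X ≈₂ total (λ v → f v n) Y

  -- Inductive step: once X and Y share all elements of rank below rank w,
  -- w ∈ X forces w ∈ Y, since otherwise the test of w sees X and Y differ by one.
  transfer : Separating → ∀ X Y → Unique X → Unique Y → All P X → All P Y →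
    SameParities X Y → ∀ w → (∀ v → rank v < rank w → (v ∈ X → v ∈ Y) × (v ∈ Y → v ∈ X)) →
    w ∈ X → w ∈ Y
  transfer sep X Y uX uY pX pY X≈Y w smaller w∈X with w ∈? Y
  ... | yes w∈Y = w∈Y
  ... | no  w∉Y with sep w (All.lookup pX w∈X)
  ...   | n , once , below = ⊥-elim (suc-≉₂ (total fₙ Y) off-by-one)
    where
      fₙ : A → ℕ
      fₙ v = f v n
      agree : ∀ v → fₙ v ≢ 0 → (v ∈ (X ─ w∈X) → v ∈ Y) × (v ∈ Y → v ∈ (X ─ w∈X))
      agree v counted =
        (λ v∈ → let v∈X = ∈-─⁻ X w∈X v∈ in
           proj₁ (smaller v (below v (All.lookup pX v∈X) counted λ { refl → ∉-─ X w∈X uX v∈ })) v∈X) ,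
        (λ v∈Y → let v≢w : v ≢ w
                     v≢w = λ { refl → w∉Y v∈Y } in
           ∈-─⁺ X w∈X (proj₂ (smaller v (below v (All.lookup pY v∈Y) counted v≢w)) v∈Y) v≢w)
      off-by-one : suc (total fₙ Y) ≈₂ total fₙ Y
      off-by-one = begin
        negOnePow (suc (total fₙ Y))
          ≡⟨ cong (negOnePow ∘ suc) (total-support fₙ Y (X ─ w∈X) uY (unique-─ X w∈X uX) (λ v c → swap (agree v c))) ⟩
        negOnePow (1 + total fₙ (X ─ w∈X))
          ≡⟨ cong (λ c → negOnePow (c + total fₙ (X ─ w∈X))) (sym once) ⟩
        negOnePow (fₙ w + total fₙ (X ─ w∈X))
          ≡⟨ cong negOnePow (sym (total-─ fₙ X w∈X)) ⟩
        negOnePow (total fₙ X)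
          ≡⟨ X≈Y n ⟩
        negOnePow (total fₙ Y) ∎

  parity-determines : Separating → ∀ X Y → Unique X → Unique Y → All P X → All P Y →
    SameParities X Y → X ≐ Y
  parity-determines sep X Y uX uY pX pY X≈Y w = bounded (suc (rank w)) w ≤-refl
    where
      bounded : ∀ b w → rank w < b → (w ∈ X → w ∈ Y) × (w ∈ Y → w ∈ X)
      bounded (suc b) w (s≤s rw≤b) =
        transfer sep X Y uX uY pX pY X≈Y w below ,
        transfer sep Y X uY uX pY pX (sym ∘ X≈Y) w (λ v rv<rw → swap (below v rv<rw))
        where
          below : ∀ v → rank v < rank w → (v ∈ X → v ∈ Y) × (v ∈ Y → v ∈ X)
          below v rv<rw = bounded b v (≤-trans rv<rw rw≤b)

indicator : Bool → ℕ
indicator true  = 1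
indicator false = 0

∑-indicator : ∀ {n} (b : Fin n) x → ∑[ c < n ] indicator (does (c ≟ᶠ b) ∧ x) ≡ indicator x
∑-indicator {suc n} zero    x = trans (cong (indicator x +_) (sum-replicate-zero n)) (+-identityʳ _)
∑-indicator {suc n} (suc b) x = ∑-indicator b x

∑-term-≤ : ∀ {n} (f : Fin n → ℕ) i → f i ≤ ∑ f
∑-term-≤ f zero    = m≤m+n (f zero) _
∑-term-≤ f (suc i) = ≤-trans (∑-term-≤ (f ∘ suc) i) (m≤n+m _ (f zero))

total-allFin : ∀ {n} (f : Fin n → ℕ) → total f (allFin n) ≡ ∑ f
total-allFin f = trans (cong sum (map-tabulate id f)) (sum-tabulate f)
  where
    sum-tabulate : ∀ {n} (g : Fin n → ℕ) → sum (tabulate g) ≡ ∑ g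
    sum-tabulate {zero}  g = refl
    sum-tabulate {suc n} g = cong (g zero +_) (sum-tabulate (g ∘ suc))

module _ {k : ℕ} where

  isPrefix-refl : ∀ (x : Word k) → isPrefix x x ≡ true
  isPrefix-refl []      = refl
  isPrefix-refl (a ∷ x) = cong₂ _∧_ (dec-true (a ≟ᶠ a) refl) (isPrefix-refl x)

  isPrefix-length : ∀ (x t : Word k) → isPrefix x t ≡ true → length x ≤ length t
  isPrefix-length []      t       _ = z≤n
  isPrefix-length (a ∷ x) (b ∷ t) e with a ≟ᶠ b
  ... | yes _ = s≤s (isPrefix-length x t e)
  isPrefix-length (a ∷ x) (b ∷ t) () | no _

  isPrefix-full : ∀ (x t : Word k) → isPrefix x t ≡ true → length t ≤ length x → x ≡ t
  isPrefix-full []      []      _ _ = refl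
  isPrefix-full (a ∷ x) (b ∷ t) e (s≤s t≤x) with a ≟ᶠ b
  ... | yes refl = cong (a ∷_) (isPrefix-full x t e t≤x)
  isPrefix-full (a ∷ x) (b ∷ t) () _ | no _

  occ-∷ : ∀ (v : Word k) c w → occ v (c ∷ w) ≡ indicator (isPrefix v (c ∷ w)) + occ v w
  occ-∷ v c w with isPrefix v (c ∷ w)
  ... | true  = refl
  ... | false = refl

  occ-[] : ∀ (v : Word k) → occ v [] ≡ indicator (isPrefix v [])
  occ-[] v with isPrefix v []
  ... | true  = refl
  ... | false = refl

  occ-too-long : ∀ (x s : Word k) → length s < length x → occ x s ≡ 0
  occ-too-long x [] s<x with isPrefix x [] in eq
  ... | true  = ⊥-elim (<⇒≱ s<x (isPrefix-length x [] eq))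
  ... | false = refl
  occ-too-long x (c ∷ s) s<x with isPrefix x (c ∷ s) in eq
  ... | true  = ⊥-elim (<⇒≱ s<x (isPrefix-length x (c ∷ s) eq))
  ... | false = occ-too-long x s (<-trans (n<1+n _) s<x)

  occ-length : ∀ (x s : Word k) → occ x s ≢ 0 → length x ≤ length s
  occ-length x s occurs = ≮⇒≥ (occurs ∘ occ-too-long x s)

  occ-at-front : ∀ (x s : Word k) → length s ≤ length x → occ x s ≢ 0 → isPrefix x s ≡ true
  occ-at-front x [] _ occurs with isPrefix x []
  ... | true  = refl
  ... | false = ⊥-elim (occurs refl)
  occ-at-front x (c ∷ s) cs≤x occurs with isPrefix x (c ∷ s)
  ... | true  = refl
  ... | false = ⊥-elim (occurs (occ-too-long x s cs≤x))

  occ-same-length : ∀ (x s : Word k) → length s ≤ length x → occ x s ≢ 0 → x ≡ s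
  occ-same-length x s s≤x occurs = isPrefix-full x s (occ-at-front x s s≤x occurs) s≤x

  occ-self : ∀ a (x : Word k) → occ (a ∷ x) (a ∷ x) ≡ 1
  occ-self a x = begin
    occ (a ∷ x) (a ∷ x)                                 ≡⟨ occ-∷ (a ∷ x) a x ⟩
    indicator (isPrefix (a ∷ x) (a ∷ x)) + occ (a ∷ x) x ≡⟨ cong₂ _+_ (cong indicator (isPrefix-refl (a ∷ x)))
                                                                    (occ-too-long (a ∷ x) x (n<1+n _)) ⟩
    1                                                   ∎

  -- An occurrence of c v at the front of b s exists only for c = b.
  extension-step : ∀ (v : Word k) b s →
    ∑[ c < k ] occ (c ∷ v) (b ∷ s) ≡ indicator (isPrefix v s) + ∑[ c < k ] occ (c ∷ v) s
  extension-step v b s = begin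
    ∑[ c < k ] occ (c ∷ v) (b ∷ s)
      ≡⟨ sum-cong-≗ (λ c → occ-∷ (c ∷ v) b s) ⟩
    ∑[ c < k ] (indicator (does (c ≟ᶠ b) ∧ isPrefix v s) + occ (c ∷ v) s)
      ≡⟨ ∑-distrib-+ (λ c → indicator (does (c ≟ᶠ b) ∧ isPrefix v s)) (λ c → occ (c ∷ v) s) ⟩
    ∑[ c < k ] indicator (does (c ≟ᶠ b) ∧ isPrefix v s) + ∑[ c < k ] occ (c ∷ v) s
      ≡⟨ cong (_+ _) (∑-indicator b (isPrefix v s)) ⟩
    indicator (isPrefix v s) + ∑[ c < k ] occ (c ∷ v) s ∎

  -- Counting all one-letter left extensions c v of v in b s amounts to
  -- counting v in s: each occurrence of v in s extends by the letter before it.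
  ∑-occ-extensions : ∀ (v : Word k) b s → ∑[ c < k ] occ (c ∷ v) (b ∷ s) ≡ occ v s
  ∑-occ-extensions v b []      = begin
    ∑[ c < k ] occ (c ∷ v) (b ∷ [])         ≡⟨ extension-step v b [] ⟩
    indicator (isPrefix v []) + ∑[ c < k ] 0 ≡⟨ cong (indicator (isPrefix v []) +_) (sum-replicate-zero k) ⟩
    indicator (isPrefix v []) + 0           ≡⟨ +-identityʳ _ ⟩
    indicator (isPrefix v [])               ≡⟨ sym (occ-[] v) ⟩
    occ v []                                ∎
  ∑-occ-extensions v b (b′ ∷ s) = begin
    ∑[ c < k ] occ (c ∷ v) (b ∷ b′ ∷ s)                         ≡⟨ extension-step v b (b′ ∷ s) ⟩
    indicator (isPrefix v (b′ ∷ s)) + ∑[ c < k ] occ (c ∷ v) (b′ ∷ s) ≡⟨ cong (indicator (isPrefix v (b′ ∷ s)) +_) (∑-occ-extensions v b′ s) ⟩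
    indicator (isPrefix v (b′ ∷ s)) + occ v s                    ≡⟨ sym (occ-∷ v b′ s) ⟩
    occ v (b′ ∷ s)                                               ∎

  -- Every occurrence of a v is followed by an occurrence of v:
  -- occ (a v) (b s) ≤ Σ_c occ (c v) (b s) = occ v s ≤ occ v (b s).
  occ-extension-≤ : ∀ a (v s : Word k) → occ (a ∷ v) s ≤ occ v s
  occ-extension-≤ a v []      = z≤n
  occ-extension-≤ a v (b ∷ s) =
    ≤-trans (∑-term-≤ (λ c → occ (c ∷ v) (b ∷ s)) a)
   (≤-trans (≤-reflexive (∑-occ-extensions v b s))
   (≤-trans (m≤n+m (occ v s) (indicator (isPrefix v (b ∷ s))))
            (≤-reflexive (sym (occ-∷ v b s)))))

-- Leading zeros.  Over the alphabet Fin (suc k) the nonzero letters are suc c.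
module _ {k : ℕ} where

  zeros : ℕ → Word (suc k)
  zeros j = replicate j zero

  NoLeadingZeroWord : Word (suc k) → Set
  NoLeadingZeroWord v = ∀ d u → v ≡ d ∷ u → ¬ toℕ d ≡ 0

  leadingZeros : Word (suc k) → ℕ
  leadingZeros []          = 0
  leadingZeros (zero  ∷ w) = suc (leadingZeros w)
  leadingZeros (suc _ ∷ w) = 0

  strip : Word (suc k) → Word (suc k)
  strip []          = []
  strip (zero  ∷ w) = strip w
  strip (suc c ∷ w) = suc c ∷ w

  strip-spec : ∀ w → zeros (leadingZeros w) ++ strip w ≡ w
  strip-spec []          = refl
  strip-spec (zero  ∷ w) = cong (zero ∷_) (strip-spec w)
  strip-spec (suc c ∷ w) = refl

  strip-head : ∀ w → ¬ IsZeroPower w → ∃[ c ] ∃[ u ] strip w ≡ suc c ∷ u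
  strip-head []          nz = ⊥-elim (nz [])
  strip-head (zero  ∷ w) nz = strip-head w (λ zp → nz (refl ∷ zp))
  strip-head (suc c ∷ w) nz = c , w , refl

  strip-noLeadingZero : ∀ {w} → NoLeadingZeroWord w → strip w ≡ w
  strip-noLeadingZero {[]}        _   = refl
  strip-noLeadingZero {zero  ∷ w} nlz = ⊥-elim (nlz zero w refl refl)
  strip-noLeadingZero {suc c ∷ w} _   = refl

  strip-injective : ∀ {v w} → length v ≡ length w → strip v ≡ strip w → v ≡ w
  strip-injective {v} {w} |v|≡|w| sv≡sw = begin
    v                                       ≡⟨ sym (strip-spec v) ⟩
    zeros (leadingZeros v) ++ strip v       ≡⟨ cong₂ (λ j x → zeros j ++ x) same-zeros sv≡sw ⟩
    zeros (leadingZeros w) ++ strip w       ≡⟨ strip-spec w ⟩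
    w                                       ∎
    where
      length-split : ∀ x → length x ≡ leadingZeros x + length (strip x)
      length-split x = begin
        length x                                      ≡⟨ cong length (sym (strip-spec x)) ⟩
        length (zeros (leadingZeros x) ++ strip x)    ≡⟨ length-++ (zeros (leadingZeros x)) ⟩
        length (zeros (leadingZeros x)) + length (strip x)
                                                      ≡⟨ cong (_+ length (strip x)) (length-replicate (leadingZeros x)) ⟩
        leadingZeros x + length (strip x)             ∎
      same-zeros : leadingZeros v ≡ leadingZeros w
      same-zeros = +-cancelʳ-≡ (length (strip v)) (leadingZeros v) (leadingZeros w)
        (trans (sym (length-split v)) (trans |v|≡|w| (trans (length-split w) (cong (λ x → leadingZeros w + length x) (sym sv≡sw)))))

  occ-skip-zeros : ∀ c (x : Word (suc k)) p s → occ (suc c ∷ x) (zeros p ++ s) ≡ occ (suc c ∷ x) s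
  occ-skip-zeros c x zero    s = refl
  occ-skip-zeros c x (suc p) s = occ-skip-zeros c x p s

  occ-strip : ∀ v p s → ¬ IsZeroPower v → occ v (zeros p ++ s) ≤ occ (strip v) s
  occ-strip v p s nz with strip-head v nz
  ... | c , x , sv≡ =
    ≤-trans (≤-reflexive (cong (λ v′ → occ v′ (zeros p ++ s)) (sym (strip-spec v))))
   (≤-trans (occ-zeros-≤ (leadingZeros v)) (≤-reflexive skip))
    where
      occ-zeros-≤ : ∀ j → occ (zeros j ++ strip v) (zeros p ++ s) ≤ occ (strip v) (zeros p ++ s)
      occ-zeros-≤ zero    = ≤-refl
      occ-zeros-≤ (suc j) = ≤-trans (occ-extension-≤ zero (zeros j ++ strip v) (zeros p ++ s)) (occ-zeros-≤ j)
      skip : occ (strip v) (zeros p ++ s) ≡ occ (strip v) s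
      skip rewrite sv≡ = occ-skip-zeros c x p s

  occ-once : ∀ j p c (u : Word (suc k)) → j ≤ p →
    occ (zeros j ++ suc c ∷ u) (zeros p ++ suc c ∷ u) ≡ 1
  occ-once j p c u j≤p with m≤n⇒m<n∨m≡n j≤p
  occ-once zero    .zero    c u _ | inj₂ refl = occ-self (suc c) u
  occ-once (suc j) .(suc j) c u _ | inj₂ refl = occ-self zero (zeros j ++ suc c ∷ u)
  occ-once j       (suc p)  c u _ | inj₁ (s≤s j≤p) = begin
    occ x (zero ∷ zeros p ++ suc c ∷ u)
      ≡⟨ occ-∷ x zero (zeros p ++ suc c ∷ u) ⟩
    indicator (isPrefix x (zeros (suc p) ++ suc c ∷ u)) + occ x (zeros p ++ suc c ∷ u)
      ≡⟨ cong₂ _+_ (cong indicator (misaligned j (suc p) (s≤s j≤p))) (occ-once j p c u j≤p) ⟩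
    1 ∎
    where
      x : Word (suc k)
      x = zeros j ++ suc c ∷ u
      -- for j < p the letter suc c of 0^j u meets a zero of 0^p u
      misaligned : ∀ j p → j < p → isPrefix (zeros j ++ suc c ∷ u) (zeros p ++ suc c ∷ u) ≡ false
      misaligned zero    (suc p) _         = refl
      misaligned (suc j) (suc p) (s≤s j<p) = misaligned j p j<p

  occ-padded-self : ∀ w → ¬ IsZeroPower w → occ w (zeros (length w ∸ 1) ++ strip w) ≡ 1
  occ-padded-self w nz with strip-head w nz
  ... | c , u , sw≡ = begin
    occ w (zeros (length w ∸ 1) ++ strip w)
      ≡⟨ cong (λ w′ → occ w′ (zeros (length w′ ∸ 1) ++ strip w)) (sym (strip-spec w)) ⟩
    occ (zeros j ++ strip w) (zeros (length (zeros j ++ strip w) ∸ 1) ++ strip w)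
      ≡⟨ cong (λ x → occ (zeros j ++ x) (zeros (length (zeros j ++ x) ∸ 1) ++ x)) sw≡ ⟩
    occ (zeros j ++ suc c ∷ u) (zeros (length (zeros j ++ suc c ∷ u) ∸ 1) ++ suc c ∷ u)
      ≡⟨ occ-once j _ c u (subst (j ≤_) (sym (cong (_∸ 1) (length-padded j))) (m≤m+n j (length u))) ⟩
    1 ∎
    where
      j : ℕ
      j = leadingZeros w
      length-padded : ∀ i → length (zeros i ++ suc c ∷ u) ≡ suc (i + length u)
      length-padded zero    = refl
      length-padded (suc i) = cong suc (length-padded i)

leftExtensions : ∀ {k} → ℕ → Word k → List (Word k)
leftExtensions     zero    v = v ∷ []
leftExtensions {k} (suc m) v = concatMap (λ c → leftExtensions m (c ∷ v)) (allFin k)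

dropLeadingZeros : ∀ {k} → Word (suc k) → List (Word (suc k))
dropLeadingZeros         []          = []
dropLeadingZeros {k}     (zero  ∷ u) = dropLeadingZeros u ++ map (λ c → suc c ∷ u) (allFin k)
dropLeadingZeros         (suc d ∷ u) = (suc d ∷ u) ∷ []

All-concatMap : {A B : Set} {P : B → Set} (g : A → List B) (L : List A) →
  (∀ {x} → x ∈ L → All P (g x)) → All P (concatMap g L)
All-concatMap g L all-g = concat⁺ (map⁺ (All.tabulate all-g))

nonzero-∷ : ∀ {k} (c : Fin k) {v} → ¬ IsZeroPower v → ¬ IsZeroPower (c ∷ v)
nonzero-∷ c nz (_ ∷ zp) = nz zp

leftExtensions-length : ∀ {k} m (v : Word k) → All (λ w → length w ≡ m + length v) (leftExtensions m v)
leftExtensions-length zero    v = refl ∷ []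
leftExtensions-length (suc m) v = All-concatMap _ (allFin _) λ {c} _ →
  All.map (λ |w| → trans |w| (+-suc m (length v))) (leftExtensions-length m (c ∷ v))

leftExtensions-nonzero : ∀ {k} m (v : Word k) → ¬ IsZeroPower v → All (¬_ ∘ IsZeroPower) (leftExtensions m v)
leftExtensions-nonzero zero    v nz = nz ∷ []
leftExtensions-nonzero (suc m) v nz = All-concatMap _ (allFin _) λ {c} _ →
  leftExtensions-nonzero m (c ∷ v) (nonzero-∷ c nz)

dropLeadingZeros-good : ∀ {k} (v : Word (suc k)) →
  All (λ w → NoLeadingZeroWord w × ¬ IsZeroPower w) (dropLeadingZeros v)
dropLeadingZeros-good []          = []
dropLeadingZeros-good (zero  ∷ u) = ++⁺ (dropLeadingZeros-good u) (map⁺ (All.tabulate λ _ →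
  (λ { _ _ refl () }) , λ { (() ∷ _) }))
dropLeadingZeros-good (suc d ∷ u) = ((λ { _ _ refl () }) , λ { (() ∷ _) }) ∷ []

module Counting (k : ℕ) (h : 2 ≤ k) where

  N : List (Word k) → ℕ → ℕ
  N A n = total (λ v → count k h v n) A

  -- Σ_c #(c v, n) = #(v, n) for nonempty v: the padding 0^{|v|} in front of
  -- (n)_k provides the letter preceding each occurrence of v.
  ∑-count-extensions : ∀ d (u : Word k) n → ∑[ c < k ] count k h (c ∷ d ∷ u) n ≡ count k h (d ∷ u) n
  ∑-count-extensions d u n =
    ∑-occ-extensions (d ∷ u) (zeroDigit h) (replicate (length u) (zeroDigit h) ++ expansion k h n)

  N-leftExtensions : ∀ m d (u : Word k) n → N (leftExtensions m (d ∷ u)) n ≡ count k h (d ∷ u) n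
  N-leftExtensions zero    d u n = +-identityʳ _
  N-leftExtensions (suc m) d u n = begin
    N (concatMap (λ c → leftExtensions m (c ∷ d ∷ u)) (allFin k)) n
      ≡⟨ total-concatMap (λ v → count k h v n) (λ c → leftExtensions m (c ∷ d ∷ u)) (allFin k) ⟩
    total (λ c → N (leftExtensions m (c ∷ d ∷ u)) n) (allFin k)
      ≡⟨ total-cong (allFin k) (λ {c} _ → N-leftExtensions m c (d ∷ u) n) ⟩
    total (λ c → count k h (c ∷ d ∷ u) n) (allFin k)
      ≡⟨ total-allFin (λ c → count k h (c ∷ d ∷ u) n) ⟩
    ∑[ c < k ] count k h (c ∷ d ∷ u) n
      ≡⟨ ∑-count-extensions d u n ⟩
    count k h (d ∷ u) n ∎

-- Removing leading zeros preserves the parity of the counts: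
-- #(0u, n) = #(u, n) - Σ_{c ≠ 0} #(cu, n), and a difference has the parity of the sum.
dropLeadingZeros-≈₂ : ∀ {k} (h : 2 ≤ suc k) (v : Word (suc k)) → ¬ IsZeroPower v → ∀ n →
  Counting.N (suc k) h (dropLeadingZeros v) n ≈₂ count (suc k) h v n
dropLeadingZeros-≈₂ h []              nz n = ⊥-elim (nz [])
dropLeadingZeros-≈₂ h (zero ∷ [])     nz n = ⊥-elim (nz (refl ∷ []))
dropLeadingZeros-≈₂ h (suc d ∷ u)     nz n = cong negOnePow (+-identityʳ (count _ h (suc d ∷ u) n))
dropLeadingZeros-≈₂ {k} h (zero ∷ e ∷ u′) nz n = begin
  negOnePow (N (dropLeadingZeros u ++ others) n)
    ≡⟨ cong negOnePow (total-++ (λ v → count (suc k) h v n) (dropLeadingZeros u) others) ⟩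
  negOnePow (N (dropLeadingZeros u) n + M)
    ≡⟨ ≈₂-+ {N (dropLeadingZeros u) n} {count (suc k) h u n} {M} {M}
            (dropLeadingZeros-≈₂ h (e ∷ u′) (λ zp → nz (refl ∷ zp)) n) refl ⟩
  negOnePow (count (suc k) h u n + M)
    ≡⟨ cong (λ t → negOnePow (t + M)) (sym split) ⟩
  negOnePow (c₀ + M + M)
    ≡⟨ cong negOnePow (trans (+-comm (c₀ + M) M) (cong (M +_) (+-comm c₀ M))) ⟩
  negOnePow (M + (M + c₀))
    ≡⟨ double-≈₂ M c₀ ⟩
  negOnePow c₀ ∎
  where
    open Counting (suc k) h
    u : Word (suc k)
    u = e ∷ u′
    others : List (Word (suc k))
    others = map (λ c → suc c ∷ u) (allFin k)
    M : ℕ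
    M = N others n
    c₀ : ℕ
    c₀ = count (suc k) h (zero ∷ u) n
    split : c₀ + M ≡ count (suc k) h u n
    split = trans (cong (c₀ +_)
                    (trans (total-map (λ v → count (suc k) h v n) (λ c → suc c ∷ u) (allFin k))
                           (total-allFin (λ c → count (suc k) h (suc c ∷ u) n))))
                  (∑-count-extensions e u′ n)

-- Every word with a nonzero first letter is a base-(k+1) expansion (n)_{k+1}.
module Expansions {k : ℕ} (h : 2 ≤ suc k) where

  -- The number written by a digit word, least significant digit first.
  value : Word (suc k) → ℕ
  value []      = 0
  value (d ∷ r) = toℕ d + value r * suc k

  -- No trailing zeros: every nonempty suffix has positive value.
  Canonical : Word (suc k) → Set
  Canonical []      = ⊤
  Canonical (d ∷ r) = 0 < value (d ∷ r) × Canonical r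

  mod-digit : ∀ d x → (toℕ d + x * suc k) mod suc k ≡ d
  mod-digit d x = toℕ-injective (begin
    toℕ ((toℕ d + x * suc k) mod suc k) ≡⟨ toℕ-fromℕ< _ ⟩
    (toℕ d + x * suc k) % suc k         ≡⟨ [m+kn]%n≡m%n (toℕ d) x (suc k) ⟩
    toℕ d % suc k                       ≡⟨ m<n⇒m%n≡m (toℕ<n d) ⟩
    toℕ d                               ∎)

  div-digit : ∀ (d : Fin (suc k)) x → (toℕ d + x * suc k) / suc k ≡ x
  div-digit d x = begin
    (toℕ d + x * suc k) / suc k            ≡⟨ +-distrib-/-∣ʳ (toℕ d) (n∣m*n x) ⟩
    toℕ d / suc k + x * suc k / suc k      ≡⟨ cong₂ _+_ (m<n⇒m/n≡0 (toℕ<n d)) (m*n/n≡m x (suc k)) ⟩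
    x                                      ∎

  digitsRev-positive : ∀ fuel {n} → 0 < n →
    digitsRev (suc k) h (suc fuel) n ≡ (n mod suc k) ∷ digitsRev (suc k) h fuel (n / suc k)
  digitsRev-positive fuel {suc n} _ = refl

  value-tail-< : ∀ d r → 0 < value (d ∷ r) → value r < value (d ∷ r)
  value-tail-< d r pos with value r
  ... | zero  = pos
  ... | suc v = ≤-trans (m<m*n (suc v) (suc k) h) (m≤n+m _ (toℕ d))

  digitsRev-value : ∀ r → Canonical r → ∀ fuel → value r ≤ fuel → digitsRev (suc k) h fuel (value r) ≡ r
  digitsRev-value []      _          zero       _ = refl
  digitsRev-value []      _          (suc fuel) _ = refl
  digitsRev-value (d ∷ r) (pos , _)  zero       v≤0 = ⊥-elim (<⇒≱ pos v≤0)
  digitsRev-value (d ∷ r) (pos , cr) (suc fuel) v≤ = begin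
    digitsRev (suc k) h (suc fuel) (value (d ∷ r))
      ≡⟨ digitsRev-positive fuel pos ⟩
    (value (d ∷ r) mod suc k) ∷ digitsRev (suc k) h fuel (value (d ∷ r) / suc k)
      ≡⟨ cong₂ _∷_ (mod-digit d (value r)) (cong (digitsRev (suc k) h fuel) (div-digit d (value r))) ⟩
    d ∷ digitsRev (suc k) h fuel (value r)
      ≡⟨ cong (d ∷_) (digitsRev-value r cr fuel (≤-pred (≤-trans (value-tail-< d r pos) v≤))) ⟩
    d ∷ r ∎

  canonical-snoc : ∀ c xs → 0 < value (xs ++ suc c ∷ []) × Canonical (xs ++ suc c ∷ [])
  canonical-snoc c []       = s≤s z≤n , s≤s z≤n , tt
  canonical-snoc c (x ∷ xs) with canonical-snoc c xs
  ... | pos , can = positive , positive , can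
    where
      positive : 0 < toℕ x + value (xs ++ suc c ∷ []) * suc k
      positive = ≤-trans (*-mono-≤ pos (s≤s z≤n)) (m≤n+m _ (toℕ x))

  expansion-onto : ∀ c u → ∃[ n ] expansion (suc k) h n ≡ suc c ∷ u
  expansion-onto c u = value r , (begin
    reverse (digitsRev (suc k) h (value r) (value r)) ≡⟨ cong reverse (digitsRev-value r canonical (value r) ≤-refl) ⟩
    reverse r                                         ≡⟨ reverse-involutive (suc c ∷ u) ⟩
    suc c ∷ u                                         ∎)
    where
      r : Word (suc k)
      r = reverse (suc c ∷ u)
      canonical : Canonical r
      canonical = subst Canonical (sym (unfold-reverse (suc c) u)) (proj₂ (canonical-snoc c (reverse u)))

-- If a class is such that words of
-- the class are determined by their stripped forms, its admissible sets are
-- determined by their pattern counting sequences; and a sequence a_A has such a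
-- representation whenever each word of A can be rewritten into the class.
module Representation {k : ℕ} (h : 2 ≤ suc k) (Class : Word (suc k) → Set)
  (strip-injective-on : ∀ {v w} → Class v → Class w → strip v ≡ strip w → v ≡ w) where

  open Counting (suc k) h
  open Expansions h

  _≟ʷ_ : DecidableEquality (Word (suc k))
  _≟ʷ_ = ≡-dec _≟ᶠ_

  Good : Word (suc k) → Set
  Good v = Class v × ¬ IsZeroPower v

  open Determination _≟ʷ_ Good (length ∘ strip) (count (suc k) h)
  open Normalisation _≟ʷ_

  -- The test for w is the n with (n)_k = strip w: it sees w exactly once, and
  -- any other word of the class it sees has a shorter stripped form.
  separating : Separating
  separating w (cw , nzw) with strip-head w nzw
  ... | c , u , sw≡ with expansion-onto c u
  ... | n , expansion≡ = n , counted-once , shorter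
    where
      test-is-strip : expansion (suc k) h n ≡ strip w
      test-is-strip = trans expansion≡ (sym sw≡)
      counted-once : count (suc k) h w n ≡ 1
      counted-once = subst (λ t → occ w (zeros (length w ∸ 1) ++ t) ≡ 1) (sym test-is-strip)
                           (occ-padded-self w nzw)
      shorter : ∀ v → Good v → count (suc k) h v n ≢ 0 → v ≢ w → length (strip v) < length (strip w)
      shorter v (cv , nzv) counted v≢w =
        ≤∧≢⇒< (occ-length (strip v) (strip w) in-strip-w)
              (λ same → v≢w (strip-injective-on cv cw
                               (occ-same-length (strip v) (strip w) (≤-reflexive (sym same)) in-strip-w)))
        where
          in-strip-w : occ (strip v) (strip w) ≢ 0
          in-strip-w none = counted (n≤0⇒n≡0 (≤-trans (occ-strip v (length v ∸ 1) (expansion (suc k) h n) nzv)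
                                                       (≤-reflexive (trans (cong (occ (strip v)) test-is-strip) none))))

  representation : (a : ℕ → ℤ) (A : List (Word (suc k))) → (∀ n → a n ≡ patSeq (suc k) h A n) →
    (R : Word (suc k) → List (Word (suc k))) →
    (∀ {v} → v ∈ A → (∀ n → N (R v) n ≈₂ count (suc k) h v n) × All Good (R v)) →
    Σ (List (Word (suc k))) λ B →
      (Admissible B × All Class B × (∀ n → a n ≡ patSeq (suc k) h B n)) ×
      (∀ B′ → Admissible B′ → All Class B′ → (∀ n → a n ≡ patSeq (suc k) h B′ n) → B′ ≐ B)
  representation a A a≡A R rewrites =
    B , ((uB , All.map proj₂ goodB) , All.map proj₁ goodB , a≡B) , determined
    where
      L : List (Word (suc k))
      L = concatMap R A
      B : List (Word (suc k))
      B = normalise L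
      uB : Unique B
      uB = normalise-unique L
      goodB : All Good B
      goodB = All.tabulate λ w∈B → All.lookup (All-concatMap R A (proj₂ ∘ rewrites)) (normalise-⊆ L w∈B)
      a≡B : ∀ n → a n ≡ patSeq (suc k) h B n
      a≡B n = trans (a≡A n) (sym (begin
        negOnePow (N B n)                                  ≡⟨ normalise-≈₂ (λ v → count (suc k) h v n) L ⟩
        negOnePow (N L n)                                  ≡⟨ cong negOnePow (total-concatMap (λ v → count (suc k) h v n) R A) ⟩
        negOnePow (total (λ v → N (R v) n) A)              ≡⟨ total-≈₂ A (λ v∈A → proj₁ (rewrites v∈A) n) ⟩
        negOnePow (N A n)                                  ∎))
      determined : ∀ B′ → Admissible B′ → All Class B′ → (∀ n → a n ≡ patSeq (suc k) h B′ n) → B′ ≐ B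
      determined B′ (uB′ , nzB′) classB′ a≡B′ =
        parity-determines separating B′ B uB′ uB (All.zip (classB′ , nzB′)) goodB
                          (λ n → trans (sym (a≡B′ n)) (a≡B n))

noLeadingZero-representation : ∀ {k} (h : 2 ≤ suc k) (a : ℕ → ℤ) (A : List (Word (suc k))) →
  (∀ n → a n ≡ patSeq (suc k) h A n) → All (¬_ ∘ IsZeroPower) A →
  Σ (List (Word (suc k))) λ B →
    (Admissible B × NoLeadingZero B × (∀ n → a n ≡ patSeq (suc k) h B n)) ×
    (∀ B′ → Admissible B′ → NoLeadingZero B′ → (∀ n → a n ≡ patSeq (suc k) h B′ n) → SameSet B′ B)
noLeadingZero-representation h a A a≡A nzA =
  representation a A a≡A dropLeadingZeros
    (λ {v} v∈A → dropLeadingZeros-≈₂ h v (All.lookup nzA v∈A) , dropLeadingZeros-good v)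
  where
    open Representation h NoLeadingZeroWord
      (λ nlz-v nlz-w sv≡sw → trans (sym (strip-noLeadingZero nlz-v)) (trans sv≡sw (strip-noLeadingZero nlz-w)))

fixedLength-representation : ∀ {k} (h : 2 ≤ suc k) (ℓ : ℕ) (a : ℕ → ℤ) (A : List (Word (suc k))) →
  (∀ n → a n ≡ patSeq (suc k) h A n) → All (¬_ ∘ IsZeroPower) A → All (λ v → length v ≤ ℓ) A →
  Σ (List (Word (suc k))) λ C →
    (Admissible C × AllLength ℓ C × (∀ n → a n ≡ patSeq (suc k) h C n)) ×
    (∀ C′ → Admissible C′ → AllLength ℓ C′ → (∀ n → a n ≡ patSeq (suc k) h C′ n) → SameSet C′ C)
fixedLength-representation {k} h ℓ a A a≡A nzA lenA =
  representation a A a≡A (λ v → leftExtensions (ℓ ∸ length v) v)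
    (λ {v} v∈A → extend v (All.lookup nzA v∈A) (All.lookup lenA v∈A))
  where
    open Representation h (λ v → length v ≡ ℓ) (λ |v|≡ℓ |w|≡ℓ → strip-injective (trans |v|≡ℓ (sym |w|≡ℓ)))
    open Counting (suc k) h
    extend : ∀ v → ¬ IsZeroPower v → length v ≤ ℓ →
      (∀ n → N (leftExtensions (ℓ ∸ length v) v) n ≈₂ count (suc k) h v n) ×
      All Good (leftExtensions (ℓ ∸ length v) v)
    extend []      nz _  = ⊥-elim (nz [])
    extend (d ∷ u) nz |v|≤ℓ =
      (λ n → cong negOnePow (N-leftExtensions (ℓ ∸ length (d ∷ u)) d u n)) ,
      All.zip (All.map (λ |w| → trans |w| (m∸n+n≡m |v|≤ℓ)) (leftExtensions-length (ℓ ∸ length (d ∷ u)) (d ∷ u)) ,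
               leftExtensions-nonzero (ℓ ∸ length (d ∷ u)) (d ∷ u) nz)

lemma2p2 : (k : ℕ) (h : 2 ≤ k) (ℓ : ℕ) (a : ℕ → ℤ) →
    IsPatternCountingSeq k h ℓ a →
    Σ (List (Word k)) λ B → Σ (List (Word k)) λ C →
      (Admissible B × NoLeadingZero B × (∀ n → a n ≡ patSeq k h B n)) ×
      (Admissible C × AllLength ℓ C × (∀ n → a n ≡ patSeq k h C n)) ×
      (∀ B′ → Admissible B′ → NoLeadingZero B′ → (∀ n → a n ≡ patSeq k h B′ n) → SameSet B′ B) ×
      (∀ C′ → Admissible C′ → AllLength ℓ C′ → (∀ n → a n ≡ patSeq k h C′ n) → SameSet C′ C)
lemma2p2 zero () ℓ a pcs
lemma2p2 (suc k) h ℓ a (A , (_ , nzA) , lenA , a≡A) =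
  let B , B-spec , B-unique = noLeadingZero-representation h a A a≡A nzA
      C , C-spec , C-unique = fixedLength-representation h ℓ a A a≡A nzA lenA
  in  B , C , B-spec , C-spec , B-unique , C-unique
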